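{- For every integer $m\geq 3$, $\lambda_1^1(P_m \times C_4)=5$.
   Context: For a graph $G$, an $L(1,1)$-labeling with labels in $\{0,1,\dots,p\}$ is a function $l:V(G)\to\{0,1,\dots,p\}$ such that $l(u)\neq l(v)$ whenever the distance $d(u,v)$ is $1$ or $2$. $\lambda_1^1(G)$ denotes the least $p$ for which $G$ admits such a labeling. $P_m$ denotes the path with $m$ vertices and $C_n$ the cycle with $n$ vertices. The direct product $G\times H$ has vertex set $V(G)\times V(H)$, with $(x_1,x_2)$ adjacent to $(y_1,y_2)$ iff $x_1y_1\in E(G)$ and $x_2y_2\in E(H)$. -}

module Defs where

open import Data.Nat using (ℕ; suc; _<_)
open import Data.Fin using (Fin; toℕ)
open import Data.Product using (Σ; _×_; ∃-syntax; proj₁; proj₂)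
open import Data.Sum using (_⊎_)
open import Relation.Binary.PropositionalEquality using (_≡_)
open import Relation.Nullary using (¬_)

record Graph : Set₁ where
  field
    V   : Set
    Adj : V → V → Set
open Graph public

P : ℕ → Graph
P m = record { V = Fin m ; Adj = λ i j → (suc (toℕ i) ≡ toℕ j) ⊎ (suc (toℕ j) ≡ toℕ i) }

CycAdj : (n : ℕ) → Fin n → Fin n → Set
CycAdj n i j = (suc (toℕ i) ≡ toℕ j) ⊎ ((suc (toℕ i) ≡ n) × (toℕ j ≡ 0))

C : ℕ → Graph
C n = record { V = Fin n ; Adj = λ i j → CycAdj n i j ⊎ CycAdj n j i }

_⊗_ : Graph → Graph → Graph
G ⊗ H = record { V = V G × V H
               ; Adj = λ x y → Adj G (proj₁ x) (proj₁ y)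
                             × Adj H (proj₂ x) (proj₂ y) }

Dist≤2 : (G : Graph) → V G → V G → Set
Dist≤2 G u v = ¬ (u ≡ v) × (Adj G u v ⊎ ∃[ w ] (Adj G u w × Adj G w v))

IsL11Labeling : (G : Graph) (p : ℕ) → (V G → Fin (suc p)) → Set
IsL11Labeling G p l = ∀ u v → Dist≤2 G u v → ¬ (l u ≡ l v)

HasL11Labeling : Graph → ℕ → Set
HasL11Labeling G p = ∃[ l ] IsL11Labeling G p l

λ11≡ : Graph → ℕ → Set
λ11≡ G k = HasL11Labeling G k × (∀ p → p < k → ¬ HasL11Labeling G p)

-- The six vertices (a, j) with a ∈ {0, 1, 2}, j ∈ C₄ and a ≡ j (mod 2) are pairwise at distance
-- at most 2 in P_m × C₄: vertices of different parity are adjacent in both factors, and vertices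
-- of equal parity are joined by a walk of length 2 in both factors.  So at least six labels are
-- needed.  Conversely (a, j) ↦ (a mod 3, ⌊j/2⌋) uses six labels: a mod 3 separates path vertices
-- at distance 1 or 2, and two vertices of C₄ joined by a walk of length 2 have the same parity,
-- so together with ⌊j/2⌋ they coincide.
module Submission where

open import Defs
open import Data.Nat using (ℕ; _≥_; suc; _+_; _*_; _<_; s≤s)
open import Data.Nat.Base using (parity)
open import Data.Nat.Properties using (suc-injective)
open import Data.Parity.Base using (Parity; 0ℙ; 1ℙ; _⁻¹)
open import Data.Parity.Properties using (_≟_; p≢p⁻¹; ⁻¹-selfInverse; suc-homo-⁻¹)
open import Data.Fin using (Fin; toℕ; _↑ˡ_; combine; remQuot)
open import Data.Fin.Patterns using (0F; 1F; 2F; 3F)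
open import Data.Fin.Properties
  using (pigeonhole; toℕ-injective; <⇒≢; ↑ˡ-injective; combine-injective; combine-remQuot)
open import Data.Product using (_×_; _,_; proj₁; proj₂; ∃-syntax; uncurry)
open import Data.Sum using (_⊎_; inj₁; inj₂)
open import Data.Empty using (⊥)
open import Function using (_∘_)
open import Relation.Binary.PropositionalEquality
  using (_≡_; _≢_; refl; sym; trans; cong; cong₂; module ≡-Reasoning)
open import Relation.Nullary using (¬_; yes; no; contradiction)

Adj² : (G : Graph) → V G → V G → Set
Adj² G u v = ∃[ w ] (Adj G u w × Adj G w v)

⊗-adj² : ∀ {G H u v x y} → Adj² G u v → Adj² H x y → Adj² (G ⊗ H) (u , x) (v , y)
⊗-adj² (w , uw , wv) (z , xz , zy) = (w , z) , (uw , xz) , (wv , zy)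

noL11Labeling-below-clique : ∀ {G n p} (v : Fin (suc n) → V G) →
  (∀ i j → i ≢ j → Dist≤2 G (v i) (v j)) → p < n → ¬ HasL11Labeling G p
noL11Labeling-below-clique v clique p<n (l , isL11)
  with i , j , i<j , li≡lj ← pigeonhole (s≤s p<n) (λ i → l (v i))
  = isL11 (v i) (v j) (clique i j (<⇒≢ i<j)) li≡lj

⊗-separates : ∀ {G H : Graph} {A B : Set} (g : V G → A) (h : V H → B) →
  (∀ {u v} → Adj G u v → g u ≢ g v) →
  (∀ {u v} → Adj² G u v → g u ≡ g v → u ≡ v) →
  (∀ {x y} → Adj² H x y → h x ≡ h y → x ≡ y) →
  ∀ p q → Dist≤2 (G ⊗ H) p q →
  g (proj₁ p) ≡ g (proj₁ q) → h (proj₂ p) ≡ h (proj₂ q) → ⊥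
⊗-separates _ _ g-adj _ _ _ _ (_ , inj₁ (uv , _)) gu≡gv _ = g-adj uv gu≡gv
⊗-separates _ _ _ g-adj² h-adj² _ _ (p≢q , inj₂ ((w , z) , (uw , xz) , (wv , zy))) gu≡gv hx≡hy =
  p≢q (cong₂ _,_ (g-adj² (w , uw , wv) gu≡gv) (h-adj² (z , xz , zy) hx≡hy))

record CompleteBipartite (G : Graph) (I : Set) : Set where
  field
    vertex      : I → V G
    colour      : I → Parity
    adjacent    : ∀ i j → colour i ≢ colour j → Adj G (vertex i) (vertex j)
    colour-onto : ∀ p → ∃[ i ] colour i ≡ p

  -- The common neighbour is any vertex of the other colour.
  adj² : ∀ i j → colour i ≡ colour j → Adj² G (vertex i) (vertex j)
  adj² i j ci≡cj with w , cw≡ci⁻¹ ← colour-onto (colour i ⁻¹) =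
    vertex w ,
    adjacent i w (λ ci≡cw → p≢p⁻¹ _ (trans ci≡cw cw≡ci⁻¹)) ,
    adjacent w j (λ cw≡cj → p≢p⁻¹ _ (trans ci≡cj (trans (sym cw≡cj) cw≡ci⁻¹)))

open CompleteBipartite

⊗-sameColour-reach : ∀ {G H I J} (K : CompleteBipartite G I) (L : CompleteBipartite H J)
  {i i′ : I} {j j′ : J} → colour K i ≡ colour L j → colour K i′ ≡ colour L j′ →
  let u = (vertex K i , vertex L j) ; u′ = (vertex K i′ , vertex L j′) in
  Adj (G ⊗ H) u u′ ⊎ Adj² (G ⊗ H) u u′
⊗-sameColour-reach {G} {H} K L {i} {i′} {j} {j′} ci≡dj ci′≡dj′ with colour K i ≟ colour K i′
... | yes ci≡ci′ = inj₂ (⊗-adj² {G} {H} (adj² K i i′ ci≡ci′) (adj² L j j′ dj≡dj′))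
  where
  dj≡dj′ : colour L j ≡ colour L j′
  dj≡dj′ = trans (sym ci≡dj) (trans ci≡ci′ ci′≡dj′)
... | no ci≢ci′ = inj₁ (adjacent K i i′ ci≢ci′ , adjacent L j j′ dj≢dj′)
  where
  dj≢dj′ : colour L j ≢ colour L j′
  dj≢dj′ = λ dj≡dj′ → ci≢ci′ (trans ci≡dj (trans dj≡dj′ (sym ci′≡dj′)))

mod₃ : ℕ → Fin 3
mod₃ 0                   = 0F
mod₃ 1                   = 1F
mod₃ 2                   = 2F
mod₃ (suc (suc (suc n))) = mod₃ n

mod₃-suc≢ : ∀ n → mod₃ (suc n) ≢ mod₃ n
mod₃-suc≢ 0                   ()
mod₃-suc≢ 1                   ()
mod₃-suc≢ 2                   ()
mod₃-suc≢ (suc (suc (suc n))) = mod₃-suc≢ n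

mod₃-suc-suc≢ : ∀ n → mod₃ (suc (suc n)) ≢ mod₃ n
mod₃-suc-suc≢ 0                   ()
mod₃-suc-suc≢ 1                   ()
mod₃-suc-suc≢ 2                   ()
mod₃-suc-suc≢ (suc (suc (suc n))) = mod₃-suc-suc≢ n

P-adj⇒mod₃≢ : ∀ {m} {a b : Fin m} → Adj (P m) a b → mod₃ (toℕ a) ≢ mod₃ (toℕ b)
P-adj⇒mod₃≢ {a = a} (inj₁ a+1≡b) rewrite sym a+1≡b = mod₃-suc≢ (toℕ a) ∘ sym
P-adj⇒mod₃≢ {b = b} (inj₂ b+1≡a) rewrite sym b+1≡a = mod₃-suc≢ (toℕ b)

P-adj²⇒mod₃-injective : ∀ {m} {a b : Fin m} →
  Adj² (P m) a b → mod₃ (toℕ a) ≡ mod₃ (toℕ b) → a ≡ b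
P-adj²⇒mod₃-injective {a = a} (c , inj₁ a+1≡c , inj₁ c+1≡b) eq
  rewrite sym c+1≡b | sym a+1≡c = contradiction (sym eq) (mod₃-suc-suc≢ (toℕ a))
P-adj²⇒mod₃-injective (c , inj₁ a+1≡c , inj₂ b+1≡c) _ =
  toℕ-injective (suc-injective (trans a+1≡c (sym b+1≡c)))
P-adj²⇒mod₃-injective (c , inj₂ c+1≡a , inj₁ c+1≡b) _ = toℕ-injective (trans (sym c+1≡a) c+1≡b)
P-adj²⇒mod₃-injective {b = b} (c , inj₂ c+1≡a , inj₂ b+1≡c) eq
  rewrite sym c+1≡a | sym b+1≡c = contradiction eq (mod₃-suc-suc≢ (toℕ b))

parity-suc : ∀ n → parity (suc n) ≡ parity n ⁻¹
parity-suc n = sym (⁻¹-selfInverse (suc-homo-⁻¹ n))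

≡⁻¹-sym : ∀ {p q : Parity} → p ≡ q ⁻¹ → q ≡ p ⁻¹
≡⁻¹-sym p≡q⁻¹ = sym (⁻¹-selfInverse (sym p≡q⁻¹))

cycleAdj-flips-parity : ∀ {n} {i j : Fin n} → parity n ≡ 0ℙ →
  CycAdj n i j → parity (toℕ j) ≡ parity (toℕ i) ⁻¹
cycleAdj-flips-parity {i = i} _ (inj₁ i+1≡j) rewrite sym i+1≡j = parity-suc (toℕ i)
cycleAdj-flips-parity {n} {i} n-even (inj₂ (i+1≡n , j≡0)) rewrite j≡0 = begin
  0ℙ                     ≡⟨ sym n-even ⟩
  parity n               ≡⟨ cong parity (sym i+1≡n) ⟩
  parity (suc (toℕ i))   ≡⟨ parity-suc (toℕ i) ⟩
  parity (toℕ i) ⁻¹      ∎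
  where open ≡-Reasoning

cycle-adj-flips-parity : ∀ {n} {i j : Fin n} → parity n ≡ 0ℙ →
  Adj (C n) i j → parity (toℕ j) ≡ parity (toℕ i) ⁻¹
cycle-adj-flips-parity n-even (inj₁ ij) = cycleAdj-flips-parity n-even ij
cycle-adj-flips-parity n-even (inj₂ ji) = ≡⁻¹-sym (cycleAdj-flips-parity n-even ji)

cycle-adj²-preserves-parity : ∀ {n} {i j : Fin n} → parity n ≡ 0ℙ →
  Adj² (C n) i j → parity (toℕ i) ≡ parity (toℕ j)
cycle-adj²-preserves-parity n-even (w , iw , wj) =
  trans (≡⁻¹-sym (cycle-adj-flips-parity n-even iw)) (sym (cycle-adj-flips-parity n-even wj))

half : Fin 4 → Fin 2
half 0F = 0F
half 1F = 0F
half 2F = 1F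
half 3F = 1F

C4-vertex : Parity → Fin 2 → Fin 4
C4-vertex 0ℙ 0F = 0F
C4-vertex 1ℙ 0F = 1F
C4-vertex 0ℙ 1F = 2F
C4-vertex 1ℙ 1F = 3F

C4-vertex-parity : ∀ p b → parity (toℕ (C4-vertex p b)) ≡ p
C4-vertex-parity 0ℙ 0F = refl
C4-vertex-parity 1ℙ 0F = refl
C4-vertex-parity 0ℙ 1F = refl
C4-vertex-parity 1ℙ 1F = refl

C4-vertex-half : ∀ p b → half (C4-vertex p b) ≡ b
C4-vertex-half 0ℙ 0F = refl
C4-vertex-half 1ℙ 0F = refl
C4-vertex-half 0ℙ 1F = refl
C4-vertex-half 1ℙ 1F = refl

C4-vertex-parity-half : ∀ j → C4-vertex (parity (toℕ j)) (half j) ≡ j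
C4-vertex-parity-half 0F = refl
C4-vertex-parity-half 1F = refl
C4-vertex-parity-half 2F = refl
C4-vertex-parity-half 3F = refl

C4-adj²⇒half-injective : ∀ {j k} → Adj² (C 4) j k → half j ≡ half k → j ≡ k
C4-adj²⇒half-injective {j} {k} jk hj≡hk = begin
  j                                    ≡⟨ sym (C4-vertex-parity-half j) ⟩
  C4-vertex (parity (toℕ j)) (half j)  ≡⟨ cong₂ C4-vertex (cycle-adj²-preserves-parity refl jk)
                                                          hj≡hk ⟩
  C4-vertex (parity (toℕ k)) (half k)  ≡⟨ C4-vertex-parity-half k ⟩
  k                                    ∎
  where open ≡-Reasoning

C4-completeBipartite : CompleteBipartite (C 4) (Fin 4)
C4-completeBipartite = record
  { vertex      = λ j → j
  ; colour      = λ j → parity (toℕ j)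
  ; adjacent    = parity≢⇒adj
  ; colour-onto = λ p → C4-vertex p 0F , C4-vertex-parity p 0F
  }
  where
  parity≢⇒adj : ∀ j k → parity (toℕ j) ≢ parity (toℕ k) → Adj (C 4) j k
  parity≢⇒adj 0F 1F _ = inj₁ (inj₁ refl)
  parity≢⇒adj 0F 3F _ = inj₂ (inj₂ (refl , refl))
  parity≢⇒adj 1F 0F _ = inj₂ (inj₁ refl)
  parity≢⇒adj 1F 2F _ = inj₁ (inj₁ refl)
  parity≢⇒adj 2F 1F _ = inj₂ (inj₁ refl)
  parity≢⇒adj 2F 3F _ = inj₁ (inj₁ refl)
  parity≢⇒adj 3F 0F _ = inj₁ (inj₂ (refl , refl))
  parity≢⇒adj 3F 2F _ = inj₂ (inj₁ refl)
  parity≢⇒adj 0F 0F neq = contradiction refl neq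
  parity≢⇒adj 0F 2F neq = contradiction refl neq
  parity≢⇒adj 1F 1F neq = contradiction refl neq
  parity≢⇒adj 1F 3F neq = contradiction refl neq
  parity≢⇒adj 2F 0F neq = contradiction refl neq
  parity≢⇒adj 2F 2F neq = contradiction refl neq
  parity≢⇒adj 3F 1F neq = contradiction refl neq
  parity≢⇒adj 3F 3F neq = contradiction refl neq

P-completeBipartite : ∀ k → CompleteBipartite (P (3 + k)) (Fin 3)
P-completeBipartite k = record
  { vertex      = _↑ˡ k
  ; colour      = λ a → parity (toℕ a)
  ; adjacent    = parity≢⇒adj
  ; colour-onto = λ { 0ℙ → 0F , refl ; 1ℙ → 1F , refl }
  }
  where
  parity≢⇒adj : ∀ a b → parity (toℕ a) ≢ parity (toℕ b) → Adj (P (3 + k)) (a ↑ˡ k) (b ↑ˡ k)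
  parity≢⇒adj 0F 1F _ = inj₁ refl
  parity≢⇒adj 1F 0F _ = inj₂ refl
  parity≢⇒adj 1F 2F _ = inj₁ refl
  parity≢⇒adj 2F 1F _ = inj₂ refl
  parity≢⇒adj 0F 0F neq = contradiction refl neq
  parity≢⇒adj 0F 2F neq = contradiction refl neq
  parity≢⇒adj 1F 1F neq = contradiction refl neq
  parity≢⇒adj 2F 0F neq = contradiction refl neq
  parity≢⇒adj 2F 2F neq = contradiction refl neq

remQuot-injective : ∀ {n} k {i j : Fin (n * k)} → remQuot {n} k i ≡ remQuot k j → i ≡ j
remQuot-injective {n} k {i} {j} eq =
  trans (sym (combine-remQuot {n} k i))
        (trans (cong (uncurry combine) eq) (combine-remQuot {n} k j))

clique : ∀ k → Fin 3 × Fin 2 → V (P (3 + k) ⊗ C 4)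
clique k (a , b) = a ↑ˡ k , C4-vertex (parity (toℕ a)) b

clique-injective : ∀ k {x y} → clique k x ≡ clique k y → x ≡ y
clique-injective k {a , b} {a′ , b′} eq with refl ← ↑ˡ-injective k a a′ (cong proj₁ eq) =
  cong (a ,_) (trans (sym (C4-vertex-half _ b))
                     (trans (cong (half ∘ proj₂) eq) (C4-vertex-half _ b′)))

clique-dist≤2 : ∀ k (i j : Fin 6) → i ≢ j →
  Dist≤2 (P (3 + k) ⊗ C 4) (clique k (remQuot {3} 2 i)) (clique k (remQuot {3} 2 j))
clique-dist≤2 k i j i≢j =
  i≢j ∘ remQuot-injective 2 ∘ clique-injective k ,
  ⊗-sameColour-reach (P-completeBipartite k) C4-completeBipartite
    (sym (C4-vertex-parity _ _)) (sym (C4-vertex-parity _ _))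

mod₃-half-isL11Labeling : ∀ m →
  IsL11Labeling (P m ⊗ C 4) 5 (λ (a , j) → combine (mod₃ (toℕ a)) (half j))
mod₃-half-isL11Labeling m p q p~q eq =
  uncurry (⊗-separates (mod₃ ∘ toℕ) half
             P-adj⇒mod₃≢ P-adj²⇒mod₃-injective C4-adj²⇒half-injective p q p~q)
          (combine-injective _ _ _ _ eq)

mainTheorem10 : (m : ℕ) → m ≥ 3 → λ11≡ (P m ⊗ C 4) 5
mainTheorem10 (suc (suc (suc k))) (s≤s (s≤s (s≤s _))) =
  (_ , mod₃-half-isL11Labeling _) ,
  λ p p<5 → noL11Labeling-below-clique (clique k ∘ remQuot 2) (clique-dist≤2 k) p<5
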